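{- A CK-frame $(X,e,\le,R)$ validates $N_{\Diamond\Box}$ ($\Diamond\bot\to\Box\bot$) whenever it satisfies ($N_{\Diamond\Box}$-suff): for all $x,y$, if $xRe$ and $xRy$ then $y=e$. Moreover, a CK-frame validates $N_{\Diamond\Box}$ if and only if it satisfies ($N_{\Diamond\Box}$-corr): for all $x$, if $yRe$ for every $y\ge x$, then for all $y,z$ with $x\le y$ and $yRz$ we have $z=e$.
   Context: Formulas are built from propositional variables, $\bot,\wedge,\vee,\to,\Box,\Diamond$. A CK-frame is $(X,e,\le,R)$ with $(X,\le)$ a preorder, $e\in X$ such that $e\le y$ implies $y=e$, and $R\subseteq X\times X$ such that $eRx$ iff $x=e$. A valuation maps each variable to an upset of $(X,\le)$ containing $e$. Forcing: $x\Vdash p$ iff $x\in V(p)$; $x\Vdash\bot$ iff $x=e$; $\wedge,\vee$ pointwise; $x\Vdash\varphi\to\psi$ iff for all $y\ge x$, $y\Vdash\varphi$ implies $y\Vdash\psi$; $x\Vdash\Box\varphi$ iff for all $y,z$ with $x\le y$ and $yRz$, $z\Vdash\varphi$; $x\Vdash\Diamond\varphi$ iff for all $y\ge x$ there is $z$ with $yRz$ and $z\Vdash\varphi$. A frame validates a formula if it is forced at every world under every valuation. -}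

module Defs where

open import Level using (0ℓ)
open import Data.Nat using (ℕ)
open import Data.Product using (Σ; _×_; _,_; ∃-syntax)
open import Data.Sum using (_⊎_)
open import Relation.Binary.PropositionalEquality using (_≡_)

data Formula : Set where
  var  : ℕ → Formula
  ⊥'   : Formula
  _∧'_ : Formula → Formula → Formula
  _∨'_ : Formula → Formula → Formula
  _⇒_  : Formula → Formula → Formula
  □_   : Formula → Formula
  ◇_   : Formula → Formula

infixr 5 _⇒_
infix 7 □_ ◇_

record CKFrame : Set₁ where
  field
    X      : Set
    e      : X
    _≤_    : X → X → Set
    ≤-refl  : ∀ {x} → x ≤ x
    ≤-trans : ∀ {x y z} → x ≤ y → y ≤ z → x ≤ z
    e-max  : ∀ {y} → e ≤ y → y ≡ e
    R      : X → X → Set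
    eR⇔    : ∀ {x} → (R e x → x ≡ e) × (x ≡ e → R e x)

module _ (F : CKFrame) where
  open CKFrame F

  record Valuation : Set₁ where
    field
      V       : ℕ → X → Set
      V-up    : ∀ {n x y} → x ≤ y → V n x → V n y
      V-e     : ∀ n → V n e

  open Valuation

  _,_⊩_ : Valuation → X → Formula → Set
  M , x ⊩ var n   = V M n x
  M , x ⊩ ⊥'      = x ≡ e
  M , x ⊩ (φ ∧' ψ) = (M , x ⊩ φ) × (M , x ⊩ ψ)
  M , x ⊩ (φ ∨' ψ) = (M , x ⊩ φ) ⊎ (M , x ⊩ ψ)
  M , x ⊩ (φ ⇒ ψ)  = ∀ y → x ≤ y → M , y ⊩ φ → M , y ⊩ ψ
  M , x ⊩ (□ φ)   = ∀ y z → x ≤ y → R y z → M , z ⊩ φ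
  M , x ⊩ (◇ φ)   = ∀ y → x ≤ y → ∃[ z ] (R y z × (M , z ⊩ φ))

  Validates : Formula → Set₁
  Validates φ = ∀ (M : Valuation) (x : X) → M , x ⊩ φ

  NDB-suff : Set
  NDB-suff = ∀ x y → R x e → R x y → y ≡ e

  NDB-corr : Set
  NDB-corr = ∀ x → (∀ y → x ≤ y → R y e) → ∀ y z → x ≤ y → R y z → z ≡ e

N◇□ : Formula
N◇□ = ◇ ⊥' ⇒ □ ⊥'

{-# OPTIONS --safe #-}
-- Neither ◇⊥ nor □⊥ depends on the valuation: ◇⊥ holds at x exactly when every
-- y ≥ x sees e, and □⊥ at x is literally the conclusion of N◇□-corr at x. Hence
-- validity of ◇⊥ → □⊥ is N◇□-corr, and N◇□-suff implies N◇□-corr because a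
-- world that sees e may see nothing else.
module Submission where

open import Defs
open import Data.Product using (_×_; _,_; ∃-syntax)
open import Data.Unit using (⊤; tt)
open import Function.Bundles using (_⇔_; mk⇔; module Equivalence)
open import Relation.Binary.PropositionalEquality using (_≡_; refl)

module _ (F : CKFrame) where
  open CKFrame F

  trivialValuation : Valuation F
  trivialValuation = record { V = λ _ _ → ⊤ ; V-up = λ _ _ → tt ; V-e = λ _ → tt }

  ⊩◇⊥⇔ : (M : Valuation F) (x : X) → _,_⊩_ F M x (◇ ⊥') ⇔ (∀ y → x ≤ y → R y e)
  ⊩◇⊥⇔ M x = mk⇔ (λ ◇⊥ y x≤y → sees-e (◇⊥ y x≤y)) (λ Re y x≤y → e , Re y x≤y , refl)
    where
    sees-e : ∀ {y} → ∃[ z ] (R y z × z ≡ e) → R y e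
    sees-e (_ , Ryz , refl) = Ryz

  NDB-suff⇒NDB-corr : NDB-suff F → NDB-corr F
  NDB-suff⇒NDB-corr suff x Re y z x≤y Ryz = suff y z (Re y x≤y) Ryz

  NDB-corr⇒N◇□ : NDB-corr F → Validates F N◇□
  NDB-corr⇒N◇□ corr M x y x≤y ◇⊥ = corr y (Equivalence.to (⊩◇⊥⇔ M y) ◇⊥)

  N◇□⇒NDB-corr : Validates F N◇□ → NDB-corr F
  N◇□⇒NDB-corr valid x Re =
    valid trivialValuation x x ≤-refl (Equivalence.from (⊩◇⊥⇔ trivialValuation x) Re)

mainTheorem14 : (F : CKFrame) →
    (NDB-suff F → Validates F N◇□) × (Validates F N◇□ ⇔ NDB-corr F)
mainTheorem14 F =
  (λ suff → NDB-corr⇒N◇□ F (NDB-suff⇒NDB-corr F suff)) ,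
  mk⇔ (N◇□⇒NDB-corr F) (NDB-corr⇒N◇□ F)
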